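{- Let $A$ be a set with $|A| = 2$, $B$ a nonempty set, and let $f \colon A^n \to B$ be determined by $\mathrm{cs}$. Then $n \leq 2$ or $f$ is totally symmetric.
   Context: The content $\mathrm{ms}(\mathbf{a})$ of a tuple $\mathbf{a}$ is the multiset of its entries; a singleton of $\mathbf{a}$ is an element occurring exactly once in $\mathbf{a}$; $\mathrm{singles}(\mathbf{a})$ is the tuple listing the singletons of $\mathbf{a}$ in their order of occurrence; $\mathrm{cs}(\mathbf{a}) := (\mathrm{ms}(\mathbf{a}),\mathrm{singles}(\mathbf{a}))$. $f \colon A^n\to B$ is determined by $\mathrm{cs}$ if $f(\mathbf{a}) = f(\mathbf{b})$ whenever $\mathbf{a},\mathbf{b}\in A^n$ satisfy $\mathrm{cs}(\mathbf{a})=\mathrm{cs}(\mathbf{b})$. $f$ is totally symmetric if $f(a_{\sigma(1)},\dots,a_{\sigma(n)}) = f(a_1,\dots,a_n)$ for all $\sigma$ in the symmetric group $S_n$ and all $(a_1,\dots,a_n)\in A^n$. -}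

module Defs where

import Data.Nat
import Data.Product
import Relation.Binary.PropositionalEquality
open import Data.Nat using (ℕ; zero; suc)
open import Data.Fin using (Fin)
import Data.Fin.Properties as FinP
open import Data.Fin.Permutation using (Permutation′; _⟨$⟩ʳ_)
open import Data.List using (List; []; _∷_; filter)
open import Data.List.Relation.Binary.Permutation.Propositional using (_↭_)
open import Data.Vec using (Vec; toList; lookup; tabulate)
open import Function.Bundles using (_↔_; Inverse)
open import Relation.Binary.Definitions using (DecidableEquality)
open import Relation.Binary.PropositionalEquality using (_≡_)
open import Relation.Nullary using (yes; no)
open import Relation.Nullary.Decidable using (map′)

decEqFrom : {A : Set} → A ↔ Fin 2 → DecidableEquality A
decEqFrom e x y = map′ inj (Relation.Binary.PropositionalEquality.cong (Inverse.to e))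
                       (Inverse.to e x FinP.≟ Inverse.to e y)
  where
  open Relation.Binary.PropositionalEquality using (trans; sym; cong)
  inj : Inverse.to e x ≡ Inverse.to e y → x ≡ y
  inj p = trans (sym (Inverse.strictlyInverseʳ e x))
                (trans (cong (Inverse.from e) p) (Inverse.strictlyInverseʳ e y))

module _ {A : Set} (_≟_ : DecidableEquality A) where

  count : A → List A → ℕ
  count x [] = 0
  count x (y ∷ ys) with x ≟ y
  ... | yes _ = suc (count x ys)
  ... | no _  = count x ys

  singles : List A → List A
  singles l = filter (λ x → count x l Data.Nat.≟ 1) l

  -- cs(a) = cs(b): same multiset of entries and same singles tuple
  SameCS : {n : ℕ} → Vec A n → Vec A n → Set
  SameCS a b = (toList a ↭ toList b) Data.Product.× (singles (toList a) ≡ singles (toList b))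

  DeterminedByCS : {B : Set} {n : ℕ} → (Vec A n → B) → Set
  DeterminedByCS {n = n} f = (a b : Vec A n) → SameCS a b → f a ≡ f b

TotallySymmetric : {A B : Set} {n : ℕ} → (Vec A n → B) → Set
TotallySymmetric {A} {n = n} f =
  (σ : Permutation′ n) (a : Vec A n) → f (tabulate (λ i → lookup a (σ ⟨$⟩ʳ i))) ≡ f a

-- With only two possible entries, a tuple of length at least three cannot contain both of
-- them exactly once, so it has at most one singleton.  The singles tuple therefore has length
-- at most one and is determined by the multiset of entries alone; as permuting a tuple
-- preserves that multiset, it preserves cs, and a function determined by cs is symmetric.
module Submission where

open import Defs
open import Data.Nat using (ℕ; zero; suc; _+_; _≤_; z≤n; s≤s; _≤?_) renaming (_≟_ to _≟ℕ_)
open import Data.Nat.Properties using (m≤n⇒m≤1+n; +-suc; <-irrefl; ≰⇒>; module ≤-Reasoning)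
open import Data.Fin using (Fin; zero; suc; punchIn)
open import Data.Fin.Permutation as Perm using (Permutation′; _⟨$⟩ʳ_; _⟨$⟩ˡ_)
open import Data.List using (List; []; _∷_; filter; length)
open import Data.List.Properties using (filter-≐)
open import Data.List.Relation.Binary.Permutation.Propositional
  using (_↭_; refl; prep; swap; trans; ↭-sym)
open import Data.List.Relation.Binary.Permutation.Propositional.Properties
  using (filter-↭; ↭-length; ↭-empty-inv; ↭-singleton-inv)
open import Data.List.Relation.Unary.All using (_∷_)
open import Data.List.Relation.Unary.All.Properties using (all-filter)
open import Data.Vec using (Vec; toList; tabulate; lookup)
open import Data.Vec.Properties using (tabulate-cong; tabulate∘lookup; length-toList)
open import Data.Sum as Sum using (_⊎_; inj₁; inj₂)
open import Data.Product using (_,_)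
open import Data.Empty using (⊥-elim)
open import Function.Base using (_∘_)
open import Function.Bundles using (_↔_; _↣_; Injection)
open import Function.Properties.Inverse using (↔⇒↣)
open import Relation.Binary.Definitions using (DecidableEquality)
open import Relation.Binary.PropositionalEquality
  using (_≡_; _≢_; cong; cong₂; sym; subst; module ≡-Reasoning)
  renaming (refl to ≡-refl; trans to ≡-trans)
open import Relation.Nullary using (yes; no; Dec)

module _ {A : Set} where

  tabulate-↭-punchIn : ∀ {n} (t : Fin (suc n) → A) (i : Fin (suc n)) →
                       toList (tabulate t) ↭ t i ∷ toList (tabulate (t ∘ punchIn i))
  tabulate-↭-punchIn t zero = refl
  tabulate-↭-punchIn {suc n} t (suc i) =
    trans (prep (t zero) (tabulate-↭-punchIn (t ∘ suc) i)) (swap (t zero) (t (suc i)) refl)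

  -- Induct by removing the entry sent to position 0 from both sides.
  tabulate-↭-permute : ∀ {n} (t : Fin n → A) (π : Permutation′ n) →
                       toList (tabulate t) ↭ toList (tabulate (t ∘ (π ⟨$⟩ʳ_)))
  tabulate-↭-permute {zero} t π = refl
  tabulate-↭-permute {suc n} t π =
    trans (prep (t zero) (tabulate-↭-permute (t ∘ suc) (Perm.remove i π)))
          (subst (_↭ toList (tabulate πt)) (sym head-tail) (↭-sym (tabulate-↭-punchIn πt i)))
    where
    i = π ⟨$⟩ˡ zero
    πt = t ∘ (π ⟨$⟩ʳ_)
    head-tail : t zero ∷ toList (tabulate (t ∘ suc ∘ (Perm.remove i π ⟨$⟩ʳ_)))
              ≡ πt i ∷ toList (tabulate (πt ∘ punchIn i))
    head-tail = cong₂ _∷_ (cong t (sym (Perm.inverseʳ π)))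
      (cong toList (tabulate-cong (λ j → cong t (sym (Perm.punchIn-permute′ π zero j)))))

  permute-↭ : ∀ {n} (σ : Permutation′ n) (a : Vec A n) →
              toList (tabulate (λ i → lookup a (σ ⟨$⟩ʳ i))) ↭ toList a
  permute-↭ σ a =
    ↭-sym (subst (λ v → toList v ↭ toList (tabulate (lookup a ∘ (σ ⟨$⟩ʳ_))))
                 (tabulate∘lookup a) (tabulate-↭-permute (lookup a) σ))

  ↭-short⇒≡ : ∀ {xs ys : List A} → length xs ≤ 1 → xs ↭ ys → xs ≡ ys
  ↭-short⇒≡ {[]}         _         p = sym (↭-empty-inv (↭-sym p))
  ↭-short⇒≡ {_ ∷ []}     _         p = sym (↭-singleton-inv (↭-sym p))
  ↭-short⇒≡ {_ ∷ _ ∷ _} (s≤s ()) _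

AtMostTwo : Set → Set
AtMostTwo A = ∀ (u v : A) → u ≢ v → ∀ z → z ≡ u ⊎ z ≡ v

atMostTwo-Fin2 : AtMostTwo (Fin 2)
atMostTwo-Fin2 zero       zero       u≢v _          = ⊥-elim (u≢v ≡-refl)
atMostTwo-Fin2 zero       (suc zero) _   zero       = inj₁ ≡-refl
atMostTwo-Fin2 zero       (suc zero) _   (suc zero) = inj₂ ≡-refl
atMostTwo-Fin2 (suc zero) zero       _   zero       = inj₂ ≡-refl
atMostTwo-Fin2 (suc zero) zero       _   (suc zero) = inj₁ ≡-refl
atMostTwo-Fin2 (suc zero) (suc zero) u≢v _          = ⊥-elim (u≢v ≡-refl)

atMostTwo-↣ : ∀ {A B : Set} → A ↣ B → AtMostTwo B → AtMostTwo A
atMostTwo-↣ ι two u v u≢v z =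
  Sum.map injective injective (two (to u) (to v) (u≢v ∘ injective) (to z))
  where open Injection ι

module _ {A : Set} (_≟_ : DecidableEquality A) where

  count≡length∘filter : ∀ x l → count _≟_ x l ≡ length (filter (x ≟_) l)
  count≡length∘filter x []      = ≡-refl
  count≡length∘filter x (y ∷ l) with x ≟ y
  ... | yes _ = cong suc (count≡length∘filter x l)
  ... | no _  = count≡length∘filter x l

  count-↭ : ∀ x {l l′} → l ↭ l′ → count _≟_ x l ≡ count _≟_ x l′
  count-↭ x {l} {l′} p = begin
    count _≟_ x l                ≡⟨ count≡length∘filter x l ⟩
    length (filter (x ≟_) l)     ≡⟨ ↭-length (filter-↭ (x ≟_) p) ⟩
    length (filter (x ≟_) l′)    ≡⟨ count≡length∘filter x l′ ⟨
    count _≟_ x l′               ∎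
    where open ≡-Reasoning

  count-∷-self : ∀ x l → count _≟_ x (x ∷ l) ≡ suc (count _≟_ x l)
  count-∷-self x l with x ≟ x
  ... | yes _  = ≡-refl
  ... | no x≢x = ⊥-elim (x≢x ≡-refl)

  count-filter-≤ : ∀ {P : A → Set} (P? : ∀ z → Dec (P z)) x l →
                   count _≟_ x (filter P? l) ≤ count _≟_ x l
  count-filter-≤ P? x []      = z≤n
  count-filter-≤ P? x (y ∷ l) with P? y
  ... | yes _ with x ≟ y
  ...   | yes _ = s≤s (count-filter-≤ P? x l)
  ...   | no _  = count-filter-≤ P? x l
  count-filter-≤ P? x (y ∷ l) | no _ with x ≟ y
  ...   | yes _ = m≤n⇒m≤1+n (count-filter-≤ P? x l)
  ...   | no _  = count-filter-≤ P? x l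

  length≡count+count : ∀ u v → u ≢ v → (∀ z → z ≡ u ⊎ z ≡ v) →
                       ∀ l → length l ≡ count _≟_ u l + count _≟_ v l
  length≡count+count u v u≢v cover []      = ≡-refl
  length≡count+count u v u≢v cover (y ∷ l) with u ≟ y | v ≟ y
  ... | yes u≡y | yes v≡y = ⊥-elim (u≢v (≡-trans u≡y (sym v≡y)))
  ... | yes _   | no _    = cong suc (length≡count+count u v u≢v cover l)
  ... | no _    | yes _   = ≡-trans (cong suc (length≡count+count u v u≢v cover l)) (sym (+-suc _ _))
  ... | no u≢y  | no v≢y  with cover y
  ...   | inj₁ y≡u = ⊥-elim (u≢y (sym y≡u))
  ...   | inj₂ y≡v = ⊥-elim (v≢y (sym y≡v))

  single? : ∀ l x → Dec (count _≟_ x l ≡ 1)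
  single? l x = count _≟_ x l ≟ℕ 1

  length-singles≤1 : AtMostTwo A → ∀ l → 3 ≤ length l → length (singles _≟_ l) ≤ 1
  length-singles≤1 two l 3≤∣l∣
    with singles _≟_ l in eq | all-filter (single? l) l
  ... | []        | _ = z≤n
  ... | _ ∷ []    | _ = s≤s z≤n
  ... | u ∷ v ∷ r | cu ∷ cv ∷ _ with u ≟ v
  ... | yes ≡-refl = ⊥-elim (<-irrefl ≡-refl (subst (2 ≤_) cu 2≤count))
    where
    open ≤-Reasoning
    2≤count : 2 ≤ count _≟_ u l
    2≤count = begin
      2                                     ≤⟨ s≤s (s≤s z≤n) ⟩
      suc (suc (count _≟_ u r))             ≡⟨ cong suc (count-∷-self u r) ⟨
      suc (count _≟_ u (u ∷ r))             ≡⟨ count-∷-self u (u ∷ r) ⟨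
      count _≟_ u (u ∷ u ∷ r)               ≡⟨ cong (count _≟_ u) eq ⟨
      count _≟_ u (singles _≟_ l)           ≤⟨ count-filter-≤ (single? l) u l ⟩
      count _≟_ u l                         ∎
  ... | no u≢v = ⊥-elim (<-irrefl ≡-refl (subst (3 ≤_) ∣l∣≡2 3≤∣l∣))
    where
    ∣l∣≡2 : length l ≡ 2
    ∣l∣≡2 = ≡-trans (length≡count+count u v u≢v (two u v u≢v) l) (cong₂ _+_ cu cv)

  singles-↭ : AtMostTwo A → ∀ {l l′} → 3 ≤ length l → l ↭ l′ → singles _≟_ l ≡ singles _≟_ l′
  singles-↭ two {l} {l′} 3≤∣l∣ p =
    ↭-short⇒≡ (length-singles≤1 two l 3≤∣l∣)
      (subst (singles _≟_ l ↭_)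
        (filter-≐ (single? l) (single? l′)
           ((λ {x} → ≡-trans (sym (count-↭ x p))) , (λ {x} → ≡-trans (count-↭ x p))) l′)
        (filter-↭ (single? l) p))

  determinedByCS⇒totallySymmetric : AtMostTwo A → ∀ {B : Set} {n} → 3 ≤ n →
    (f : Vec A n → B) → DeterminedByCS _≟_ f → TotallySymmetric f
  determinedByCS⇒totallySymmetric two 3≤n f det σ a =
    det σa a (σa↭a , singles-↭ two (subst (3 ≤_) (sym (length-toList σa)) 3≤n) σa↭a)
    where
    σa = tabulate (λ i → lookup a (σ ⟨$⟩ʳ i))
    σa↭a = permute-↭ σ a

lemma3p5 : (A B : Set) (e : A ↔ Fin 2) (b : B) (n : ℕ) (f : Vec A n → B)
           → DeterminedByCS (decEqFrom e) f
           → n ≤ 2 ⊎ TotallySymmetric f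
lemma3p5 A B e _ n f det with n ≤? 2
... | yes n≤2 = inj₁ n≤2
... | no n≰2  = inj₂ (determinedByCS⇒totallySymmetric (decEqFrom e)
                       (atMostTwo-↣ (↔⇒↣ e) atMostTwo-Fin2) (≰⇒> n≰2) f det)
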